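{- Let $p\equiv1\pmod5$ be a prime, $T$ a generator of the group of characters of $\mathbb{F}_p$, $t=\frac{p-1}{5}$, and $a,b,c\in\mathbb{Z}$ with $a+c\not\equiv0$ and $b+c\not\equiv0\pmod5$. Then \[ \sum_{e=0}^{p-2}T^e(-1)\,J\big(T^{ -e+at},T^{ -e+bt},T^{e+ct}\big)=-(p-1). \]
   Context: Characters of $\mathbb{F}_p^*$ are extended to $\mathbb{F}_p$ by $\chi(0)=0$ (including the trivial character). The generalised Jacobi sum is $J(\chi_1,\dots,\chi_k)=\sum_{t_1+\cdots+t_k=1,\ t_i\in\mathbb{F}_p}\chi_1(t_1)\cdots\chi_k(t_k)$. -}

module Defs where

open import Level using (Level)
open import Data.Nat as ℕ using (ℕ; zero; suc; NonZero; _∸_; _%_)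
open import Data.Nat.DivMod using (m%n<n)
open import Data.Integer as ℤ using (ℤ; +_; -[1+_])
open import Data.Fin using (Fin; toℕ; fromℕ<)
open import Data.Bool using (if_then_else_)
open import Relation.Nullary using (¬_; does; yes; no)
open import Data.Product using (_×_)
open import Data.Sum using (_⊎_)
open import Algebra.Bundles using (CommutativeRing)

-- Integral domain hypothesis on a commutative ring (ℂ is the paper's ring).
IsIntegralDomain : ∀ {c ℓ} → CommutativeRing c ℓ → Set (c Level.⊔ ℓ)
IsIntegralDomain R = (¬ (1# ≈ 0#)) × (∀ x y → x * y ≈ 0# → (x ≈ 0#) ⊎ (y ≈ 0#))
  where open CommutativeRing R

module _ {c ℓ} (R : CommutativeRing c ℓ) (p : ℕ) .{{_ : NonZero p}} where
  open CommutativeRing R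

  [_] : ℕ → Fin p
  [ n ] = fromℕ< (m%n<n n p)

  _·_ : Fin p → Fin p → Fin p
  x · y = [ toℕ x ℕ.* toℕ y ]

  ι : ℕ → Carrier
  ι zero = 0#
  ι (suc n) = 1# + ι n

  _^_ : Carrier → ℕ → Carrier
  x ^ zero = 1#
  x ^ suc n = x * (x ^ n)

  ∑Fin : ∀ {n} → (Fin n → Carrier) → Carrier
  ∑Fin {zero} f = 0#
  ∑Fin {suc n} f = f Fin.zero + ∑Fin (λ i → f (Fin.suc i))

  ∑< : ℕ → (ℕ → Carrier) → Carrier
  ∑< zero f = 0#
  ∑< (suc n) f = ∑< n f + f n

  IsCharacter : (Fin p → Carrier) → Set ℓ
  IsCharacter T =
    (T [ 0 ] ≈ 0#) × (T [ 1 ] ≈ 1#) ×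
    (∀ x y → ¬ (toℕ x ≡ 0) → ¬ (toℕ y ≡ 0) → T (x · y) ≈ T x * T y)
    where open import Relation.Binary.PropositionalEquality using (_≡_)

  -- T generates the (cyclic, order p-1) character group: T^k is nontrivial for 0 < k < p-1
  IsGenerator : (Fin p → Carrier) → Set ℓ
  IsGenerator T = IsCharacter T ×
    (∀ k → 0 ℕ.< k → k ℕ.< p ∸ 1 →
       ¬ (∀ x → ¬ (toℕ x ≡ 0) → T x ^ k ≈ 1#))
    where open import Relation.Binary.PropositionalEquality using (_≡_)

  -- the character T^e (e ∈ ℤ), extended to F_p by T^e(0) = 0 (also for the trivial
  -- character).  On F_p^*, T^{-(n+1)}(x) = T(x)^{(p-2)(n+1)} since T(x)^{p-1} = 1.
  charPow : (Fin p → Carrier) → ℤ → Fin p → Carrier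
  charPow T e x with toℕ x ℕ.≟ 0
  ... | yes _ = 0#
  ... | no _ with e
  ...   | + n = T x ^ n
  ...   | -[1+ n ] = T x ^ ((p ∸ 2) ℕ.* suc n)

  J₃ : (Fin p → Carrier) → (Fin p → Carrier) → (Fin p → Carrier) → Carrier
  J₃ χ₁ χ₂ χ₃ = ∑Fin λ t₁ → ∑Fin λ t₂ → ∑Fin λ t₃ →
    if does (((toℕ t₁ ℕ.+ toℕ t₂ ℕ.+ toℕ t₃) % p) ℕ.≟ (1 % p))
    then χ₁ t₁ * χ₂ t₂ * χ₃ t₃
    else 0#

module Submission where

-- Expanding the Jacobi sums and summing over e first, the contribution of
-- t₁, t₂, t₃ ∈ 𝔽ₚ* is T^A(t₁) T^B(t₂) T^C(t₃) · Σₑ T(w)ᵉ with w = −t₃/(t₁t₂), and by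
-- orthogonality Σₑ T(w)ᵉ = (p − 1)·[t₃ = −t₁t₂]. On the plane t₁ + t₂ + t₃ = 1 this
-- condition reads (1 − t₁)(1 − t₂) = 0, so only the lines t₁ = 1 and t₂ = 1 remain.
-- As t = (p − 1)/5 is even, T^C(−1) = 1; the two lines then contribute (p − 1)·Σ T^{(b+c)t}
-- and (p − 1)·Σ T^{(a+c)t}, both 0 since 5 ∤ b + c, a + c, and their common point
-- contributes p − 1, whence the total −(p − 1).
-- The orthogonality relations hold for characters with values in any integral domain:
-- Σₓ T(x)ᵏ = 0 (0 < k < p − 1) because the sum is invariant under x ↦ yx, and
-- Σₑ T(u)ᵉ = 0 (u ≠ 1) because (T(u) − 1)·Σₑ T(u)ᵉ = T(u)^{p−1} − 1 = 0, unless T(u) = 1,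
-- in which case p − 1 = 0 in R and the sum, p − 1, vanishes all the same.

open import Data.Nat as ℕ using (ℕ; zero; suc; NonZero; _∸_; _%_; _/_; z<s; s<s)
open import Data.Nat.DivMod using (m*n/n≡m; m≡m%n+[m/n]*n; m%n<n; m<n⇒m%n≡m; m%n%n≡m%n; %-distribˡ-+; %-distribˡ-*; [m+kn]%n≡m%n)
open import Data.Nat.Divisibility using (divides; m%n≡0⇒n∣m; n∣m⇒m%n≡0)
open import Data.Nat.Primality using (Prime; euclidsLemma; prime⇒irreducible)
open import Data.Integer.DivMod using (a≡a%ℕn+[a/ℕn]*n; n%ℕd<d)
open import Data.Integer.Divisibility using () renaming (_∣_ to _∣ℤ_)
open import Data.Nat.Coprimality using (prime⇒coprime; coprime-Bézout)
open import Data.Nat.GCD using (module Bézout)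
open import Data.Nat.Tactic.RingSolver using (solve-∀)
import Data.Nat.Properties as ℕ
open import Data.Integer as ℤ using (ℤ; +_; -[1+_]; _⊖_)
import Data.Integer.Properties as ℤ
import Data.Integer.Divisibility as ℤ
open import Data.Fin as Fin using (Fin; toℕ)
import Data.Fin.Properties as Fin
open import Data.Fin.Permutation using (Permutation′; permutation; _⟨$⟩ʳ_)
open import Data.Bool using (Bool; true; false; if_then_else_; _∨_)
open import Data.Product using (_,_; proj₁; proj₂; ∃)
open import Function.Bundles using (_⇔_; mk⇔; module Equivalence)
open import Data.Sum using (_⊎_; inj₁; inj₂; [_,_]′; map₁)
open import Data.Empty using (⊥-elim)
open import Relation.Nullary using (¬_; Dec; does; yes; no)
open import Relation.Nullary.Decidable using (does-⇔; _⊎-dec_)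
open import Relation.Binary.PropositionalEquality as ≡ using (_≡_; _≢_)
open import Function using (_∘_; id)
open import Algebra.Bundles using (CommutativeRing; module Ring)
import Defs
open Defs using (IsIntegralDomain)

finite-choice : ∀ {a b} {n} {P : Fin n → Set a} {B : Set b} →
                (∀ i → P i ⊎ B) → (∀ i → P i) ⊎ B
finite-choice {n = zero} h = inj₁ λ ()
finite-choice {n = suc n} {P} h with h Fin.zero | finite-choice {P = λ i → P (Fin.suc i)} (λ i → h (Fin.suc i))
... | inj₂ b | _       = inj₂ b
... | inj₁ _ | inj₂ b  = inj₂ b
... | inj₁ x | inj₁ xs = inj₁ λ { Fin.zero → x ; (Fin.suc i) → xs i }

%ℕ≡0⇒∣ : ∀ z d .{{_ : NonZero d}} → z ℤ.%ℕ d ≡ 0 → + d ∣ℤ z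
%ℕ≡0⇒∣ z d r≡0 = divides ℤ.∣ z ℤ./ℕ d ∣ (begin
  ℤ.∣ z ∣                                     ≡⟨ ≡.cong ℤ.∣_∣ (a≡a%ℕn+[a/ℕn]*n z d) ⟩
  ℤ.∣ + (z ℤ.%ℕ d) ℤ.+ z ℤ./ℕ d ℤ.* + d ∣     ≡⟨ ≡.cong (λ r → ℤ.∣ + r ℤ.+ z ℤ./ℕ d ℤ.* + d ∣) r≡0 ⟩
  ℤ.∣ + 0 ℤ.+ z ℤ./ℕ d ℤ.* + d ∣              ≡⟨ ≡.cong ℤ.∣_∣ (ℤ.+-identityˡ (z ℤ./ℕ d ℤ.* + d)) ⟩
  ℤ.∣ z ℤ./ℕ d ℤ.* + d ∣                      ≡⟨ ℤ.abs-* (z ℤ./ℕ d) (+ d) ⟩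
  ℤ.∣ z ℤ./ℕ d ∣ ℕ.* d                        ∎)
  where open ≡.≡-Reasoning

module RingProperties {c ℓ} (R : CommutativeRing c ℓ) where
  open CommutativeRing R
  open import Relation.Binary.Reasoning.Setoid setoid
  open import Algebra.Properties.Semiring.Sum semiring public
    using (sum; sum-syntax; sum-cong-≋; sum-cong-≗; sum-replicate-zero; sum-init-last;
           ∑-distrib-+; ∑-comm; ∑-permute; *-distribˡ-sum)
  open import Algebra.Properties.CommutativeMonoid.Sum *-commutativeMonoid public
    using () renaming (sum to product; sum-cong-≋ to product-cong-≋;
                       sum-remove to product-remove; ∑-permute to ∏-permute;
                       ∑-distrib-+ to ∏-distrib-*; sum-replicate to product-replicate)
  open import Algebra.Properties.CommutativeSemiring.Exp commutativeSemiring public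
    using (_^_; ^-congˡ; ^-congʳ; ^-homo-*; ^-assocʳ; ^-distrib-*)
  open import Algebra.Properties.Ring ring public using (-1*x≈-x)
  open import Algebra.Properties.RingWithoutOne (Ring.ringWithoutOne ring) public using ([y-z]x≈yx-zx)
  open import Algebra.Properties.Group +-group public using (x∙y⁻¹≈ε⇒x≈y; x≈y⇒x∙y⁻¹≈ε; ε⁻¹≈ε; quasigroup)
  open import Algebra.Properties.Quasigroup quasigroup public using () renaming (cancelʳ to +-cancelʳ)
  open import Algebra.Properties.CommutativeSemigroup *-commutativeSemigroup public using (x∙yz≈yx∙z; x∙yz≈y∙xz)
  open import Algebra.Solver.Ring.NaturalCoefficients.Default commutativeSemiring public

  1^n≈1 : ∀ n → 1# ^ n ≈ 1#
  1^n≈1 zero    = refl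
  1^n≈1 (suc n) = trans (*-identityˡ _) (1^n≈1 n)

  x-0≈x : ∀ x → x - 0# ≈ x
  x-0≈x x = trans (+-congˡ ε⁻¹≈ε) (+-identityʳ x)

  sum-≈0 : ∀ {n} {f : Fin n → Carrier} → (∀ i → f i ≈ 0#) → sum f ≈ 0#
  sum-≈0 {n} f≈0 = trans (sum-cong-≋ f≈0) (sum-replicate-zero n)

  product-≈0 : ∀ {n} (f : Fin n → Carrier) j → f j ≈ 0# → product f ≈ 0#
  product-≈0 f Fin.zero    fj≈0 = trans (*-congʳ fj≈0) (zeroˡ _)
  product-≈0 f (Fin.suc j) fj≈0 = trans (*-congˡ (product-≈0 (λ i → f (Fin.suc i)) j fj≈0)) (zeroʳ _)

  sum-δ : ∀ {n} (k : Fin n) (f : Fin n → Carrier) →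
          ∑[ i < n ] (if does (i Fin.≟ k) then f i else 0#) ≈ f k
  sum-δ {suc n} Fin.zero f = trans (+-congˡ (sum-≈0 {n} λ _ → refl)) (+-identityʳ _)
  sum-δ (Fin.suc k) f = trans (+-identityˡ _) (trans (sum-cong-≋ same) (sum-δ k (λ i → f (Fin.suc i))))
    where
    same : ∀ i → (if does (Fin.suc i Fin.≟ Fin.suc k) then f (Fin.suc i) else 0#)
                 ≈ (if does (i Fin.≟ k) then f (Fin.suc i) else 0#)
    same i with i Fin.≟ k
    ... | yes _ = refl
    ... | no _  = refl

  *-if : ∀ b x y → x * (if b then y else 0#) ≈ (if b then x * y else 0#)
  *-if true  x y = refl
  *-if false x y = zeroʳ x

  if-cong : ∀ b {x y} → x ≈ y → (if b then x else 0#) ≈ (if b then y else 0#)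
  if-cong true  x≈y = x≈y
  if-cong false x≈y = refl

  if-≈0 : ∀ b {x} → x ≈ 0# → (if b then x else 0#) ≈ 0#
  if-≈0 true  x≈0 = x≈0
  if-≈0 false x≈0 = refl

  sum-if : ∀ {n} b (f : Fin n → Carrier) →
           ∑[ i < n ] (if b then f i else 0#) ≈ (if b then sum f else 0#)
  sum-if     true  f = refl
  sum-if {n} false f = sum-replicate-zero n

  if-∨ : ∀ a b x → (if a ∨ b then x else 0#) ≈
         (if a then x else 0#) + (if b then x else 0#) - (if a then (if b then x else 0#) else 0#)
  if-∨ true  true  x = sym (trans (+-assoc x x (- x)) (trans (+-congˡ (-‿inverseʳ x)) (+-identityʳ x)))
  if-∨ true  false x = sym (trans (x-0≈x _) (+-identityʳ x))
  if-∨ false true  x = sym (trans (x-0≈x _) (+-identityˡ x))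
  if-∨ false false x = sym (trans (x-0≈x _) (+-identityˡ 0#))

  sum-+- : ∀ {n} (f g h : Fin n → Carrier) →
           ∑[ i < n ] (f i + g i - h i) ≈ sum f + sum g - sum h
  sum-+- {n} f g h = begin
    ∑[ i < n ] (f i + g i - h i)            ≈⟨ ∑-distrib-+ (λ i → f i + g i) (λ i → - h i) ⟩
    ∑[ i < n ] (f i + g i) + ∑[ i < n ] (- h i) ≈⟨ +-cong (∑-distrib-+ f g) sum-neg ⟩
    sum f + sum g - sum h                   ∎
    where
    sum-neg : ∑[ i < n ] (- h i) ≈ - sum h
    sum-neg = trans (sum-cong-≋ {n} λ i → sym (-1*x≈-x (h i)))
                    (trans (sym (*-distribˡ-sum (- 1#) h)) (-1*x≈-x _))

  sum-if-∨ : ∀ {m} k (g : Fin m → Fin m → Carrier) →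
    ∑[ i < m ] ∑[ j < m ] (if does (i Fin.≟ k) ∨ does (j Fin.≟ k) then g i j else 0#)
      ≈ ∑[ j < m ] g k j + ∑[ i < m ] g i k - g k k
  sum-if-∨ {m} k g = begin
    ∑[ i < m ] ∑[ j < m ] (if a i ∨ a j then g i j else 0#)
      ≈⟨ sum-cong-≋ (λ i → trans (sum-cong-≋ (λ j → if-∨ (a i) (a j) (g i j))) (sum-+- (F i) (G i) (H i))) ⟩
    ∑[ i < m ] (sum (F i) + sum (G i) - sum (H i))
      ≈⟨ sum-+- (λ i → sum (F i)) (λ i → sum (G i)) (λ i → sum (H i)) ⟩
    ∑[ i < m ] sum (F i) + ∑[ i < m ] sum (G i) - ∑[ i < m ] sum (H i)
      ≈⟨ +-cong (+-cong (trans (sum-cong-≋ (λ i → sum-if (a i) (g i))) (sum-δ k (λ i → sum (g i))))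
                        (sum-cong-≋ (λ i → sum-δ k (g i))))
                (-‿cong (trans (sum-cong-≋ (λ i → sum-if (a i) (G i)))
                        (trans (sum-δ k (λ i → sum (G i))) (sum-δ k (g k))))) ⟩
    ∑[ j < m ] g k j + ∑[ i < m ] g i k - g k k ∎
    where
    a : Fin m → Bool
    a i = does (i Fin.≟ k)
    F G H : Fin m → Fin m → Carrier
    F i j = if a i then g i j else 0#
    G i j = if a j then g i j else 0#
    H i j = if a i then G i j else 0#

  if-if-comm : ∀ a b x → (if a then (if b then x else 0#) else 0#) ≡ (if b then (if a then x else 0#) else 0#)
  if-if-comm true  true  x = ≡.refl
  if-if-comm true  false x = ≡.refl
  if-if-comm false true  x = ≡.refl
  if-if-comm false false x = ≡.refl

  *-*-≈0 : ∀ {x y z} → x ≈ 0# ⊎ y ≈ 0# ⊎ z ≈ 0# → x * y * z ≈ 0#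
  *-*-≈0 (inj₁ x≈0)        = trans (*-congʳ (trans (*-congʳ x≈0) (zeroˡ _))) (zeroˡ _)
  *-*-≈0 (inj₂ (inj₁ y≈0)) = trans (*-congʳ (trans (*-congˡ y≈0) (zeroʳ _))) (zeroˡ _)
  *-*-≈0 (inj₂ (inj₂ z≈0)) = trans (*-congˡ z≈0) (zeroʳ _)

  ∑³ : ∀ {m} → (Fin m → Fin m → Fin m → Carrier) → Carrier
  ∑³ {m} f = ∑[ i < m ] ∑[ j < m ] ∑[ k < m ] f i j k

  ∑³-cong : ∀ {m} {f g : Fin m → Fin m → Fin m → Carrier} → (∀ i j k → f i j k ≈ g i j k) → ∑³ f ≈ ∑³ g
  ∑³-cong f≈g = sum-cong-≋ λ i → sum-cong-≋ λ j → sum-cong-≋ λ k → f≈g i j k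

  *-distribˡ-∑³ : ∀ {m} x (f : Fin m → Fin m → Fin m → Carrier) → x * ∑³ f ≈ ∑³ (λ i j k → x * f i j k)
  *-distribˡ-∑³ {m} x f = trans (*-distribˡ-sum x (λ i → ∑[ j < m ] ∑[ k < m ] f i j k)) (sum-cong-≋ λ i →
                          trans (*-distribˡ-sum x (λ j → ∑[ k < m ] f i j k)) (sum-cong-≋ λ j → *-distribˡ-sum x (f i j)))

  ∑-∑³-comm : ∀ {l m} (f : Fin l → Fin m → Fin m → Fin m → Carrier) →
              ∑[ e < l ] ∑³ (f e) ≈ ∑³ (λ i j k → ∑[ e < l ] f e i j k)
  ∑-∑³-comm {l} {m} f = trans (∑-comm (λ e i → ∑[ j < m ] ∑[ k < m ] f e i j k)) (sum-cong-≋ λ i →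
                        trans (∑-comm (λ e j → ∑[ k < m ] f e i j k)) (sum-cong-≋ λ j → ∑-comm (λ e k → f e i j k)))

  geometric-sum : ∀ x m → x * ∑[ e < m ] (x ^ toℕ e) + 1# ≈ ∑[ e < m ] (x ^ toℕ e) + x ^ m
  geometric-sum x zero    = +-congʳ (zeroʳ x)
  geometric-sum x (suc m) = begin
    x * (1# + ∑[ e < m ] (x * x ^ toℕ e)) + 1# ≈⟨ +-congʳ (*-congˡ (+-congˡ (sym (*-distribˡ-sum {m} x (λ e → x ^ toℕ e))))) ⟩
    x * (1# + x * G) + 1#                    ≈⟨ +-congʳ (*-congˡ (+-comm 1# _)) ⟩
    x * (x * G + 1#) + 1#                    ≈⟨ +-congʳ (*-congˡ (geometric-sum x m)) ⟩
    x * (G + x ^ m) + 1#                     ≈⟨ solve 3 (λ x g y → x :* (g :+ y) :+ con 1 := (con 1 :+ x :* g) :+ x :* y) refl x G (x ^ m) ⟩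
    1# + x * G + x * x ^ m                   ≈⟨ +-congʳ (+-congˡ (*-distribˡ-sum {m} x (λ e → x ^ toℕ e))) ⟩
    1# + ∑[ e < m ] (x * x ^ toℕ e) + x * x ^ m ∎
    where G = ∑[ e < m ] (x ^ toℕ e)

  module _ (domain : IsIntegralDomain R) where

    fixed-point-of-* : ∀ {x y} → x * y ≈ y → x ≈ 1# ⊎ y ≈ 0#
    fixed-point-of-* {x} {y} xy≈y = map₁ (x∙y⁻¹≈ε⇒x≈y x 1#) (proj₂ domain (x - 1#) y
      (trans ([y-z]x≈yx-zx y x 1#) (x≈y⇒x∙y⁻¹≈ε (trans xy≈y (sym (*-identityˡ y))))))

  module UnitPowers (τ τ⁻¹ : Carrier) (ττ⁻¹≈1 : τ * τ⁻¹ ≈ 1#) where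

    pow : ℤ → Carrier
    pow (+ m)    = τ ^ m
    pow -[1+ m ] = τ⁻¹ ^ suc m

    pow-⊖ : ∀ a b → pow (a ⊖ b) ≈ τ ^ a * τ⁻¹ ^ b
    pow-⊖ a       zero    = sym (*-identityʳ _)
    pow-⊖ zero    (suc b) = sym (*-identityˡ _)
    pow-⊖ (suc a) (suc b) = begin
      pow (suc a ⊖ suc b)             ≡⟨ ≡.cong pow (ℤ.[1+m]⊖[1+n]≡m⊖n a b) ⟩
      pow (a ⊖ b)                     ≈⟨ pow-⊖ a b ⟩
      τ ^ a * τ⁻¹ ^ b                 ≈⟨ *-identityˡ _ ⟨
      1# * (τ ^ a * τ⁻¹ ^ b)          ≈⟨ *-congʳ ττ⁻¹≈1 ⟨
      τ * τ⁻¹ * (τ ^ a * τ⁻¹ ^ b)     ≈⟨ solve 4 (λ x y a b → x :* y :* (a :* b) := x :* a :* (y :* b)) refl τ τ⁻¹ (τ ^ a) (τ⁻¹ ^ b) ⟩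
      τ * τ ^ a * (τ⁻¹ * τ⁻¹ ^ b)     ∎

    pow-homo-+ : ∀ z w → pow (z ℤ.+ w) ≈ pow z * pow w
    pow-homo-+ (+ a)    (+ c)    = ^-homo-* τ a c
    pow-homo-+ (+ a)    -[1+ d ] = pow-⊖ a (suc d)
    pow-homo-+ -[1+ b ] (+ c)    = trans (pow-⊖ c (suc b)) (*-comm _ _)
    pow-homo-+ -[1+ b ] -[1+ d ] = trans (^-congʳ τ⁻¹ (≡.cong suc (≡.sym (ℕ.+-suc b d)))) (^-homo-* τ⁻¹ (suc b) (suc d))

    pow-neg : ∀ m → pow (ℤ.- (+ m)) ≈ τ⁻¹ ^ m
    pow-neg zero    = refl
    pow-neg (suc m) = refl

    pow-multiple : ∀ k → τ ^ k ≈ 1# → ∀ z → pow (z ℤ.* + k) ≈ 1#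
    pow-multiple k τ^k≈1 (+ m) = begin
      pow (+ m ℤ.* + k)  ≡⟨ ≡.cong pow (ℤ.pos-* m k) ⟨
      τ ^ (m ℕ.* k)      ≡⟨ ≡.cong (τ ^_) (ℕ.*-comm m k) ⟩
      τ ^ (k ℕ.* m)      ≈⟨ ^-assocʳ τ k m ⟨
      (τ ^ k) ^ m        ≈⟨ ^-congˡ m τ^k≈1 ⟩
      1# ^ m             ≈⟨ 1^n≈1 m ⟩
      1#                 ∎
    pow-multiple k τ^k≈1 -[1+ m ] = begin
      pow (-[1+ m ] ℤ.* + k)       ≡⟨ ≡.cong pow (≡.trans (≡.sym (ℤ.neg-distribˡ-* (+ suc m) (+ k))) (≡.cong ℤ.-_ (≡.sym (ℤ.pos-* (suc m) k)))) ⟩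
      pow (ℤ.- + (suc m ℕ.* k))    ≈⟨ pow-neg (suc m ℕ.* k) ⟩
      τ⁻¹ ^ (suc m ℕ.* k)          ≡⟨ ≡.cong (τ⁻¹ ^_) (ℕ.*-comm (suc m) k) ⟩
      τ⁻¹ ^ (k ℕ.* suc m)          ≈⟨ ^-assocʳ τ⁻¹ k (suc m) ⟨
      (τ⁻¹ ^ k) ^ suc m            ≈⟨ ^-congˡ (suc m) τ⁻¹^k≈1 ⟩
      1# ^ suc m                   ≈⟨ 1^n≈1 (suc m) ⟩
      1#                           ∎
      where
      τ⁻¹^k≈1 : τ⁻¹ ^ k ≈ 1#
      τ⁻¹^k≈1 = begin
        τ⁻¹ ^ k              ≈⟨ *-identityʳ _ ⟨
        τ⁻¹ ^ k * 1#         ≈⟨ *-congˡ τ^k≈1 ⟨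
        τ⁻¹ ^ k * τ ^ k      ≈⟨ ^-distrib-* τ⁻¹ τ k ⟨
        (τ⁻¹ * τ) ^ k        ≈⟨ ^-congˡ k (trans (*-comm τ⁻¹ τ) ττ⁻¹≈1) ⟩
        1# ^ k               ≈⟨ 1^n≈1 k ⟩
        1#                   ∎

module DefsProperties {c ℓ} (R : CommutativeRing c ℓ) (p : ℕ) .{{_ : NonZero p}} where
  open CommutativeRing R
  open RingProperties R

  ∑Fin≡sum : ∀ {n} (f : Fin n → Carrier) → Defs.∑Fin R p f ≡ sum f
  ∑Fin≡sum {zero}  f = ≡.refl
  ∑Fin≡sum {suc n} f = ≡.cong (λ s → f Fin.zero + s) (∑Fin≡sum (λ i → f (Fin.suc i)))

  ^≡^ : ∀ x n → Defs._^_ R p x n ≡ x ^ n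
  ^≡^ x zero    = ≡.refl
  ^≡^ x (suc n) = ≡.cong (x *_) (^≡^ x n)

  ι≡sum-1 : ∀ n → Defs.ι R p n ≡ ∑[ i < n ] 1#
  ι≡sum-1 zero    = ≡.refl
  ι≡sum-1 (suc n) = ≡.cong (λ s → 1# + s) (ι≡sum-1 n)

  geometric-sum-of-1 : ∀ {x} m → x ≈ 1# → ∑[ e < m ] (x ^ toℕ e) ≈ Defs.ι R p m
  geometric-sum-of-1 {x} m x≈1 = trans (sum-cong-≋ {m} λ e → trans (^-congˡ (toℕ e) x≈1) (1^n≈1 (toℕ e)))
                                     (reflexive (≡.sym (ι≡sum-1 m)))

  J₃≈∑³ : ∀ (χ₁ χ₂ χ₃ : Fin p → Carrier) → Defs.J₃ R p χ₁ χ₂ χ₃ ≈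
          ∑³ (λ t₁ t₂ t₃ → if does ((toℕ t₁ ℕ.+ toℕ t₂ ℕ.+ toℕ t₃) % p ℕ.≟ 1 % p) then χ₁ t₁ * χ₂ t₂ * χ₃ t₃ else 0#)
  J₃≈∑³ χ₁ χ₂ χ₃ = reflexive (≡.trans (∑Fin≡sum (λ t₁ → Defs.∑Fin R p λ t₂ → Defs.∑Fin R p (summand t₁ t₂)))
                    (sum-cong-≗ λ t₁ → ≡.trans (∑Fin≡sum (λ t₂ → Defs.∑Fin R p (summand t₁ t₂)))
                    (sum-cong-≗ λ t₂ → ∑Fin≡sum (summand t₁ t₂))))
    where
    summand : Fin p → Fin p → Fin p → Carrier
    summand t₁ t₂ t₃ = if does ((toℕ t₁ ℕ.+ toℕ t₂ ℕ.+ toℕ t₃) % p ℕ.≟ 1 % p) then χ₁ t₁ * χ₂ t₂ * χ₃ t₃ else 0#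

  ∑<≈sum : ∀ n (f : ℕ → Carrier) → Defs.∑< R p n f ≈ ∑[ i < n ] f (toℕ i)
  ∑<≈sum zero    f = refl
  ∑<≈sum (suc n) f = sym (trans (sum-init-last {n} (λ i → f (toℕ i)))
    (+-cong (trans (sum-cong-≋ {n} λ i → reflexive (≡.cong f (Fin.toℕ-inject₁ i))) (sym (∑<≈sum n f)))
            (reflexive (≡.cong f (Fin.toℕ-fromℕ n)))))

module PrimeField (n : ℕ) (isPrime : Prime (suc (suc n))) where
  open import Data.Nat.Divisibility using (_∣_)
  open ≡ using (refl; sym; trans; cong; cong₂)
  open ≡.≡-Reasoning

  p : ℕ
  p = suc (suc n)

  -- [_] and _·_ unfold to Defs.[_] R p and Defs._·_ R p, so the laws of
  -- Defs.IsCharacter apply to them verbatim.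
  [_] : ℕ → Fin p
  [ a ] = Fin.fromℕ< (m%n<n a p)

  infixl 7 _·_
  _·_ : Fin p → Fin p → Fin p
  x · y = [ toℕ x ℕ.* toℕ y ]

  1F -1F : Fin p
  1F  = Fin.suc Fin.zero
  -1F = [ suc n ]

  Nonzero : Fin p → Set
  Nonzero x = toℕ x ≢ 0

  Nonzero-suc : ∀ i → Nonzero (Fin.suc i)
  Nonzero-suc i ()

  %-congʳ-+ : ∀ a {b c} → b % p ≡ c % p → (a ℕ.+ b) % p ≡ (a ℕ.+ c) % p
  %-congʳ-+ a {b} {c} eq = begin
    (a ℕ.+ b) % p             ≡⟨ %-distribˡ-+ a b p ⟩
    (a % p ℕ.+ b % p) % p     ≡⟨ cong (λ z → (a % p ℕ.+ z) % p) eq ⟩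
    (a % p ℕ.+ c % p) % p     ≡⟨ %-distribˡ-+ a c p ⟨
    (a ℕ.+ c) % p             ∎

  %-congʳ-* : ∀ a {b c} → b % p ≡ c % p → (a ℕ.* b) % p ≡ (a ℕ.* c) % p
  %-congʳ-* a {b} {c} eq = begin
    (a ℕ.* b) % p             ≡⟨ %-distribˡ-* a b p ⟩
    (a % p ℕ.* (b % p)) % p   ≡⟨ cong (λ z → (a % p ℕ.* z) % p) eq ⟩
    (a % p ℕ.* (c % p)) % p   ≡⟨ %-distribˡ-* a c p ⟨
    (a ℕ.* c) % p             ∎

  1%p≡1 : 1 % p ≡ 1
  1%p≡1 = m<n⇒m%n≡m {n = p} (s<s z<s)

  toℕ-[] : ∀ a → toℕ [ a ] ≡ a % p
  toℕ-[] a = Fin.toℕ-fromℕ< (m%n<n a p)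

  []-cong : ∀ {a b} → a % p ≡ b % p → [ a ] ≡ [ b ]
  []-cong {a} {b} eq = Fin.toℕ-injective (trans (toℕ-[] a) (trans eq (sym (toℕ-[] b))))

  []-toℕ : ∀ x → [ toℕ x ] ≡ x
  []-toℕ x = Fin.toℕ-injective (trans (toℕ-[] (toℕ x)) (m<n⇒m%n≡m (Fin.toℕ<n x)))

  toℕ-·-%p : ∀ x y → toℕ (x · y) % p ≡ (toℕ x ℕ.* toℕ y) % p
  toℕ-·-%p x y = trans (cong (_% p) (toℕ-[] (toℕ x ℕ.* toℕ y))) (m%n%n≡m%n (toℕ x ℕ.* toℕ y) p)

  ·-comm : ∀ x y → x · y ≡ y · x
  ·-comm x y = cong [_] (ℕ.*-comm (toℕ x) (toℕ y))

  ·-assoc : ∀ x y z → (x · y) · z ≡ x · (y · z)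
  ·-assoc x y z = []-cong {toℕ (x · y) ℕ.* toℕ z} {toℕ x ℕ.* toℕ (y · z)} (begin
    (toℕ (x · y) ℕ.* toℕ z) % p        ≡⟨ cong (_% p) (ℕ.*-comm (toℕ (x · y)) (toℕ z)) ⟩
    (toℕ z ℕ.* toℕ (x · y)) % p        ≡⟨ %-congʳ-* (toℕ z) (toℕ-·-%p x y) ⟩
    (toℕ z ℕ.* (toℕ x ℕ.* toℕ y)) % p  ≡⟨ cong (_% p) (solve-∀-ℕ (toℕ x) (toℕ y) (toℕ z)) ⟩
    (toℕ x ℕ.* (toℕ y ℕ.* toℕ z)) % p  ≡⟨ %-congʳ-* (toℕ x) (toℕ-·-%p y z) ⟨
    (toℕ x ℕ.* toℕ (y · z)) % p        ∎)
    where
    solve-∀-ℕ : ∀ a b c → c ℕ.* (a ℕ.* b) ≡ a ℕ.* (b ℕ.* c)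
    solve-∀-ℕ = solve-∀

  ·-identityˡ : ∀ x → 1F · x ≡ x
  ·-identityˡ x = trans (cong [_] (ℕ.*-identityˡ (toℕ x))) ([]-toℕ x)

  ·-identityʳ : ∀ x → x · 1F ≡ x
  ·-identityʳ x = trans (·-comm x 1F) (·-identityˡ x)

  p∣a⇒a≡0 : ∀ {a} → a ℕ.< p → p ∣ a → a ≡ 0
  p∣a⇒a≡0 {a} a<p p∣a = trans (sym (m<n⇒m%n≡m a<p)) (n∣m⇒m%n≡0 a p p∣a)

  Nonzero-· : ∀ {x y} → Nonzero x → Nonzero y → Nonzero (x · y)
  Nonzero-· {x} {y} x≢0 y≢0 xy≡0
    with euclidsLemma (toℕ x) (toℕ y) isPrime (m%n≡0⇒n∣m (toℕ x ℕ.* toℕ y) p (trans (sym (toℕ-[] (toℕ x ℕ.* toℕ y))) xy≡0))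
  ... | inj₁ p∣x = x≢0 (p∣a⇒a≡0 (Fin.toℕ<n x) p∣x)
  ... | inj₂ p∣y = y≢0 (p∣a⇒a≡0 (Fin.toℕ<n y) p∣y)

  inverse-mod-p : ∀ a → a ≢ 0 → a ℕ.< p → ∃ λ v → (a ℕ.* v) % p ≡ 1
  inverse-mod-p zero       a≢0 _   = ⊥-elim (a≢0 refl)
  inverse-mod-p a@(suc _) _   a<p with coprime-Bézout (prime⇒coprime isPrime a<p)
  ... | Bézout.-+ u v eq = v , (begin
    (a ℕ.* v) % p       ≡⟨ cong (_% p) (ℕ.*-comm a v) ⟩
    (v ℕ.* a) % p       ≡⟨ cong (_% p) eq ⟨
    (1 ℕ.+ u ℕ.* p) % p ≡⟨ [m+kn]%n≡m%n 1 u p ⟩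
    1                   ∎)
  ... | Bézout.+- u v eq = v ℕ.* suc n , (begin
    (a ℕ.* (v ℕ.* suc n)) % p                     ≡⟨ [m+kn]%n≡m%n (a ℕ.* (v ℕ.* suc n)) u p ⟨
    (a ℕ.* (v ℕ.* suc n) ℕ.+ u ℕ.* p) % p         ≡⟨ cong (λ z → (a ℕ.* (v ℕ.* suc n) ℕ.+ z) % p) eq ⟨
    (a ℕ.* (v ℕ.* suc n) ℕ.+ (1 ℕ.+ v ℕ.* a)) % p ≡⟨ cong (_% p) (rearrange a v n) ⟩
    (1 ℕ.+ (v ℕ.* a) ℕ.* p) % p                   ≡⟨ [m+kn]%n≡m%n 1 (v ℕ.* a) p ⟩
    1                                             ∎)
    where
    rearrange : ∀ a v n → a ℕ.* (v ℕ.* suc n) ℕ.+ (1 ℕ.+ v ℕ.* a) ≡ 1 ℕ.+ (v ℕ.* a) ℕ.* suc (suc n)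
    rearrange = solve-∀

  inv : (x : Fin p) → Nonzero x → Fin p
  inv x x≢0 = [ proj₁ (inverse-mod-p (toℕ x) x≢0 (Fin.toℕ<n x)) ]

  ·-inverseʳ : ∀ x (x≢0 : Nonzero x) → x · inv x x≢0 ≡ 1F
  ·-inverseʳ x x≢0 = []-cong {toℕ x ℕ.* toℕ (inv x x≢0)} {1} (begin
    (toℕ x ℕ.* toℕ [ v ]) % p ≡⟨ %-congʳ-* (toℕ x) (trans (cong (_% p) (toℕ-[] v)) (m%n%n≡m%n v p)) ⟩
    (toℕ x ℕ.* v) % p         ≡⟨ proj₂ (inverse-mod-p (toℕ x) x≢0 (Fin.toℕ<n x)) ⟩
    1                         ≡⟨ 1%p≡1 ⟨
    1 % p                     ∎)
    where v = proj₁ (inverse-mod-p (toℕ x) x≢0 (Fin.toℕ<n x))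

  ·-inverseˡ : ∀ x (x≢0 : Nonzero x) → inv x x≢0 · x ≡ 1F
  ·-inverseˡ x x≢0 = trans (·-comm _ x) (·-inverseʳ x x≢0)

  Nonzero-inv : ∀ x (x≢0 : Nonzero x) → Nonzero (inv x x≢0)
  Nonzero-inv x x≢0 inv≡0 = Nonzero-suc Fin.zero (begin
    toℕ 1F                             ≡⟨ cong toℕ (·-inverseʳ x x≢0) ⟨
    toℕ (x · inv x x≢0)                ≡⟨ toℕ-[] (toℕ x ℕ.* toℕ (inv x x≢0)) ⟩
    (toℕ x ℕ.* toℕ (inv x x≢0)) % p    ≡⟨ cong (λ z → (toℕ x ℕ.* z) % p) inv≡0 ⟩
    (toℕ x ℕ.* 0) % p                  ≡⟨ cong (_% p) (ℕ.*-zeroʳ (toℕ x)) ⟩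
    0                                  ∎)

  ·-transpose : ∀ {u v y z} → u · v ≡ 1F → u · y ≡ z ⇔ y ≡ v · z
  ·-transpose {u} {v} {y} {z} uv≡1 = mk⇔ to from
    where
    to : u · y ≡ z → y ≡ v · z
    to uy≡z = begin
      y           ≡⟨ ·-identityˡ y ⟨
      1F · y      ≡⟨ cong (_· y) (trans (·-comm v u) uv≡1) ⟨
      (v · u) · y ≡⟨ ·-assoc v u y ⟩
      v · (u · y) ≡⟨ cong (v ·_) uy≡z ⟩
      v · z       ∎
    from : y ≡ v · z → u · y ≡ z
    from refl = trans (sym (·-assoc u v z)) (trans (cong (_· z) uv≡1) (·-identityˡ z))

  unsuc : Fin p → Fin (suc n)
  unsuc Fin.zero    = Fin.zero
  unsuc (Fin.suc i) = i

  suc-unsuc : ∀ {y} → Nonzero y → Fin.suc (unsuc y) ≡ y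
  suc-unsuc {Fin.zero}  y≢0 = ⊥-elim (y≢0 refl)
  suc-unsuc {Fin.suc i} y≢0 = refl

  ·-permutation : ∀ x → Nonzero x → Permutation′ (suc n)
  ·-permutation x x≢0 = permutation (scale x) (scale x⁻¹)
    (cancel x x⁻¹ (Nonzero-inv x x≢0) (·-inverseʳ x x≢0)) (cancel x⁻¹ x x≢0 (·-inverseˡ x x≢0))
    where
    x⁻¹ = inv x x≢0
    scale : Fin p → Fin (suc n) → Fin (suc n)
    scale y i = unsuc (y · Fin.suc i)
    cancel : ∀ y z → Nonzero z → y · z ≡ 1F → ∀ i → scale y (scale z i) ≡ i
    cancel y z z≢0 yz≡1 i = cong unsuc (begin
      y · Fin.suc (unsuc (z · Fin.suc i)) ≡⟨ cong (y ·_) (suc-unsuc (Nonzero-· z≢0 (Nonzero-suc i))) ⟩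
      y · (z · Fin.suc i)                 ≡⟨ ·-assoc y z (Fin.suc i) ⟨
      (y · z) · Fin.suc i                 ≡⟨ cong (_· Fin.suc i) yz≡1 ⟩
      1F · Fin.suc i                      ≡⟨ ·-identityˡ (Fin.suc i) ⟩
      Fin.suc i                           ∎)

  suc-·-permutation : ∀ x (x≢0 : Nonzero x) i → Fin.suc (·-permutation x x≢0 ⟨$⟩ʳ i) ≡ x · Fin.suc i
  suc-·-permutation x x≢0 i = suc-unsuc (Nonzero-· x≢0 (Nonzero-suc i))

  toℕ-[-1] : toℕ -1F ≡ suc n
  toℕ-[-1] = trans (toℕ-[] (suc n)) (m<n⇒m%n≡m (ℕ.n<1+n (suc n)))

  Nonzero-[-1] : Nonzero -1F
  Nonzero-[-1] -1≡0 with trans (sym toℕ-[-1]) -1≡0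
  ... | ()

  -1·-1≡1 : -1F · -1F ≡ 1F
  -1·-1≡1 = []-cong {toℕ -1F ℕ.* toℕ -1F} {1} (begin
    (toℕ -1F ℕ.* toℕ -1F) % p ≡⟨ cong₂ (λ a b → (a ℕ.* b) % p) toℕ-[-1] toℕ-[-1] ⟩
    (suc n ℕ.* suc n) % p     ≡⟨ cong (_% p) (square n) ⟩
    (1 ℕ.+ n ℕ.* p) % p       ≡⟨ [m+kn]%n≡m%n 1 n p ⟩
    1                         ≡⟨ 1%p≡1 ⟨
    1 % p                     ∎)
    where
    square : ∀ n → suc n ℕ.* suc n ≡ 1 ℕ.+ n ℕ.* suc (suc n)
    square = solve-∀

  quotient : ∀ t₁ t₂ → Nonzero t₁ → Nonzero t₂ → Fin p → Fin p
  quotient t₁ t₂ t₁≢0 t₂≢0 t₃ = inv (t₁ · t₂) (Nonzero-· t₁≢0 t₂≢0) · (-1F · t₃)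

  quotient≡1⇔ : ∀ t₁ t₂ (t₁≢0 : Nonzero t₁) (t₂≢0 : Nonzero t₂) t₃ →
                quotient t₁ t₂ t₁≢0 t₂≢0 t₃ ≡ 1F ⇔ t₃ ≡ -1F · (t₁ · t₂)
  quotient≡1⇔ t₁ t₂ t₁≢0 t₂≢0 t₃ = mk⇔
    (λ q≡1 → Equivalence.to negate (trans (Equivalence.to divide q≡1) (·-identityʳ (t₁ · t₂))))
    (λ t₃≡ → Equivalence.from divide (trans (Equivalence.from negate t₃≡) (sym (·-identityʳ (t₁ · t₂)))))
    where
    divide = ·-transpose {inv (t₁ · t₂) (Nonzero-· t₁≢0 t₂≢0)} {t₁ · t₂} { -1F · t₃} {1F}
                         (·-inverseˡ (t₁ · t₂) (Nonzero-· t₁≢0 t₂≢0))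
    negate = ·-transpose { -1F} { -1F} {t₃} {t₁ · t₂} -1·-1≡1

  OnPlane : Fin p → Fin p → Fin p → Set
  OnPlane t₁ t₂ t₃ = (toℕ t₁ ℕ.+ toℕ t₂ ℕ.+ toℕ t₃) % p ≡ 1 % p

  [1+m]%p≡1⇒p∣m : ∀ m → (1 ℕ.+ m) % p ≡ 1 % p → p ∣ m
  [1+m]%p≡1⇒p∣m m eq = divides ((1 ℕ.+ m) / p) (ℕ.suc-injective (begin
    1 ℕ.+ m                                  ≡⟨ m≡m%n+[m/n]*n (1 ℕ.+ m) p ⟩
    (1 ℕ.+ m) % p ℕ.+ (1 ℕ.+ m) / p ℕ.* p    ≡⟨ cong (ℕ._+ (1 ℕ.+ m) / p ℕ.* p) (trans eq 1%p≡1) ⟩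
    1 ℕ.+ (1 ℕ.+ m) / p ℕ.* p                ∎))

  -- t₁ + t₂ − t₁t₂ = 1 + (p − 1)(t₁ − 1)(t₂ − 1) mod p, with tᵢ − 1 written as a, b
  -- and −1 as p − 1 so that the identity stays in ℕ.
  plane-residue : ∀ a b → (toℕ (Fin.suc a) ℕ.+ toℕ (Fin.suc b) ℕ.+ toℕ (-1F · (Fin.suc a · Fin.suc b))) % p
                          ≡ (1 ℕ.+ suc n ℕ.* (toℕ a ℕ.* toℕ b)) % p
  plane-residue a b = begin
    (A ℕ.+ B ℕ.+ toℕ (-1F · (Fin.suc a · Fin.suc b))) % p
      ≡⟨ %-congʳ-+ (A ℕ.+ B) {toℕ (-1F · (Fin.suc a · Fin.suc b))} {suc n ℕ.* (A ℕ.* B)}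
           (trans (toℕ-·-%p -1F (Fin.suc a · Fin.suc b)) (trans (cong (λ z → (z ℕ.* toℕ (Fin.suc a · Fin.suc b)) % p) toℕ-[-1])
                                                             (%-congʳ-* (suc n) {toℕ (Fin.suc a · Fin.suc b)} {A ℕ.* B} (toℕ-·-%p (Fin.suc a) (Fin.suc b))))) ⟩
    (A ℕ.+ B ℕ.+ suc n ℕ.* (A ℕ.* B)) % p
      ≡⟨ cong (_% p) (expand (toℕ a) (toℕ b) n) ⟩
    (1 ℕ.+ suc n ℕ.* (toℕ a ℕ.* toℕ b) ℕ.+ (1 ℕ.+ toℕ a ℕ.+ toℕ b) ℕ.* p) % p
      ≡⟨ [m+kn]%n≡m%n (1 ℕ.+ suc n ℕ.* (toℕ a ℕ.* toℕ b)) (1 ℕ.+ toℕ a ℕ.+ toℕ b) p ⟩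
    (1 ℕ.+ suc n ℕ.* (toℕ a ℕ.* toℕ b)) % p
      ∎
    where
    A = suc (toℕ a)
    B = suc (toℕ b)
    expand : ∀ x y n → suc x ℕ.+ suc y ℕ.+ suc n ℕ.* (suc x ℕ.* suc y)
                       ≡ 1 ℕ.+ suc n ℕ.* (x ℕ.* y) ℕ.+ (1 ℕ.+ x ℕ.+ y) ℕ.* suc (suc n)
    expand = solve-∀

  on-plane⇔ : ∀ a b → OnPlane (Fin.suc a) (Fin.suc b) (-1F · (Fin.suc a · Fin.suc b)) ⇔ (Fin.suc a ≡ 1F ⊎ Fin.suc b ≡ 1F)
  on-plane⇔ a b = mk⇔ to from
    where
    ≡1F : ∀ {c : Fin (suc n)} → p ∣ toℕ c → Fin.suc c ≡ 1F
    ≡1F {c} p∣c = cong Fin.suc (Fin.toℕ-injective (p∣a⇒a≡0 (ℕ.m<n⇒m<1+n (Fin.toℕ<n c)) p∣c))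
    to : OnPlane (Fin.suc a) (Fin.suc b) (-1F · (Fin.suc a · Fin.suc b)) → Fin.suc a ≡ 1F ⊎ Fin.suc b ≡ 1F
    to on with euclidsLemma (suc n) (toℕ a ℕ.* toℕ b) isPrime
                 ([1+m]%p≡1⇒p∣m (suc n ℕ.* (toℕ a ℕ.* toℕ b)) (trans (sym (plane-residue a b)) on))
    ... | inj₁ p∣p-1 with p∣a⇒a≡0 (ℕ.n<1+n (suc n)) p∣p-1
    ...   | ()
    to on | inj₂ p∣ab with euclidsLemma (toℕ a) (toℕ b) isPrime p∣ab
    ...   | inj₁ p∣a = inj₁ (≡1F p∣a)
    ...   | inj₂ p∣b = inj₂ (≡1F p∣b)
    from : Fin.suc a ≡ 1F ⊎ Fin.suc b ≡ 1F → OnPlane (Fin.suc a) (Fin.suc b) (-1F · (Fin.suc a · Fin.suc b))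
    from (inj₁ refl) = trans (plane-residue a b) (cong (λ z → (1 ℕ.+ z) % p) (ℕ.*-zeroʳ (suc n)))
    from (inj₂ refl) = trans (plane-residue a b)
      (cong (λ z → (1 ℕ.+ z) % p) (trans (cong (suc n ℕ.*_) (ℕ.*-zeroʳ (toℕ a))) (ℕ.*-zeroʳ (suc n))))


  module OneModFive (p%5≡1 : p % 5 ≡ 1) where

    t : ℕ
    t = suc n / 5

    p-1≡t*5 : suc n ≡ t ℕ.* 5
    p-1≡t*5 = trans p-1≡[p/5]*5 (cong (ℕ._* 5) (trans (sym (m*n/n≡m (p / 5) 5)) (cong (_/ 5) (sym p-1≡[p/5]*5))))
      where
      p-1≡[p/5]*5 : suc n ≡ p / 5 ℕ.* 5
      p-1≡[p/5]*5 = ℕ.suc-injective (trans (m≡m%n+[m/n]*n p 5) (cong (ℕ._+ p / 5 ℕ.* 5) p%5≡1))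

    odd-t⇒2∣p : ∀ k → t ≡ 1 ℕ.+ k ℕ.* 2 → 2 ∣ p
    odd-t⇒2∣p k t≡1+2k = divides (3 ℕ.+ 5 ℕ.* k) (trans (cong suc (trans p-1≡t*5 (cong (ℕ._* 5) t≡1+2k))) (double k))
      where
      double : ∀ k → suc ((1 ℕ.+ k ℕ.* 2) ℕ.* 5) ≡ (3 ℕ.+ 5 ℕ.* k) ℕ.* 2
      double = solve-∀

    2≢p : 2 ≢ p
    2≢p 2≡p = 1≢m*5 t (trans (ℕ.suc-injective 2≡p) p-1≡t*5)
      where
      1≢m*5 : ∀ m → 1 ≢ m ℕ.* 5
      1≢m*5 zero    ()
      1≢m*5 (suc m) ()

    t-even : ∃ λ s → t ≡ s ℕ.* 2
    t-even with t % 2 in t%2 | m%n<n t 2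
    ... | 0           | _ = t / 2 , trans (m≡m%n+[m/n]*n t 2) (cong (ℕ._+ t / 2 ℕ.* 2) t%2)
    ... | 1           | _ = ⊥-elim ([ (λ ()) , 2≢p ]′ (prime⇒irreducible isPrime
                                (odd-t⇒2∣p (t / 2) (trans (m≡m%n+[m/n]*n t 2) (cong (ℕ._+ t / 2 ℕ.* 2) t%2)))))
    ... | suc (suc _) | s<s (s<s ())

module Character {c ℓ} (R : CommutativeRing c ℓ) (domain : IsIntegralDomain R)
                 (n : ℕ) (isPrime : Prime (suc (suc n)))
                 (T : Fin (suc (suc n)) → CommutativeRing.Carrier R)
                 (generator : Defs.IsGenerator R (suc (suc n)) T) where
  open CommutativeRing R
  open RingProperties R
  open DefsProperties R (suc (suc n))
  open PrimeField n isPrime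
  open import Relation.Binary.Reasoning.Setoid setoid

  T-0 : T Fin.zero ≈ 0#
  T-0 = proj₁ (proj₁ generator)

  T-1 : T 1F ≈ 1#
  T-1 = proj₁ (proj₂ (proj₁ generator))

  T-· : ∀ x y → Nonzero x → Nonzero y → T (x · y) ≈ T x * T y
  T-· = proj₂ (proj₂ (proj₁ generator))

  T-inv : ∀ x (x≢0 : Nonzero x) → T x * T (inv x x≢0) ≈ 1#
  T-inv x x≢0 = trans (sym (T-· x _ x≢0 (Nonzero-inv x x≢0))) (trans (reflexive (≡.cong T (·-inverseʳ x x≢0))) T-1)

  T-0^suc : ∀ k → T Fin.zero ^ suc k ≈ 0#
  T-0^suc k = trans (*-congʳ T-0) (zeroˡ _)

  T-permute : ∀ x (x≢0 : Nonzero x) i → T (Fin.suc (·-permutation x x≢0 ⟨$⟩ʳ i)) ≈ T x * T (Fin.suc i)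
  T-permute x x≢0 i = trans (reflexive (≡.cong T (suc-·-permutation x x≢0 i))) (T-· x (Fin.suc i) x≢0 (Nonzero-suc i))

  T-fermat : ∀ x → Nonzero x → T x ^ suc n ≈ 1#
  T-fermat x x≢0 = begin
    T x ^ suc n               ≈⟨ *-identityʳ _ ⟨
    T x ^ suc n * 1#          ≈⟨ *-congˡ PQ≈1 ⟨
    T x ^ suc n * (P * Q)     ≈⟨ *-assoc _ _ _ ⟨
    T x ^ suc n * P * Q       ≈⟨ *-congʳ P-invariant ⟨
    P * Q                     ≈⟨ PQ≈1 ⟩
    1#                        ∎
    where
    P Q : Carrier
    P = product (λ i → T (Fin.suc i))
    Q = product (λ i → T (inv (Fin.suc i) (Nonzero-suc i)))
    PQ≈1 : P * Q ≈ 1#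
    PQ≈1 = begin
      P * Q                                              ≈⟨ ∏-distrib-* (λ i → T (Fin.suc i)) (λ i → T (inv (Fin.suc i) (Nonzero-suc i))) ⟨
      product (λ i → T (Fin.suc i) * T (inv (Fin.suc i) (Nonzero-suc i))) ≈⟨ product-cong-≋ (λ i → T-inv (Fin.suc i) (Nonzero-suc i)) ⟩
      product {suc n} (λ _ → 1#)                         ≈⟨ trans (product-replicate (suc n)) (1^n≈1 (suc n)) ⟩
      1#                                                 ∎
    P-invariant : P ≈ T x ^ suc n * P
    P-invariant = begin
      P                                           ≈⟨ ∏-permute (λ i → T (Fin.suc i)) (·-permutation x x≢0) ⟩
      product (λ i → T (Fin.suc (·-permutation x x≢0 ⟨$⟩ʳ i))) ≈⟨ product-cong-≋ (T-permute x x≢0) ⟩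
      product (λ i → T x * T (Fin.suc i))         ≈⟨ ∏-distrib-* (λ _ → T x) (λ i → T (Fin.suc i)) ⟩
      product {suc n} (λ _ → T x) * P             ≈⟨ *-congʳ (product-replicate (suc n)) ⟩
      T x ^ suc n * P                             ∎

  T-inv≈T^[p-2] : ∀ x (x≢0 : Nonzero x) → T (inv x x≢0) ≈ T x ^ n
  T-inv≈T^[p-2] x x≢0 = begin
    T x⁻¹                         ≈⟨ *-identityʳ _ ⟨
    T x⁻¹ * 1#                    ≈⟨ *-congˡ (T-fermat x x≢0) ⟨
    T x⁻¹ * (T x * T x ^ n)       ≈⟨ *-assoc _ _ _ ⟨
    T x⁻¹ * T x * T x ^ n         ≈⟨ *-congʳ (trans (*-comm _ _) (T-inv x x≢0)) ⟩
    1# * T x ^ n                  ≈⟨ *-identityˡ _ ⟩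
    T x ^ n                       ∎
    where x⁻¹ = inv x x≢0

  T-quotient : ∀ t₁ t₂ (t₁≢0 : Nonzero t₁) (t₂≢0 : Nonzero t₂) t₃ → Nonzero t₃ →
    T (quotient t₁ t₂ t₁≢0 t₂≢0 t₃) ≈ T t₁ ^ n * T t₂ ^ n * (T -1F * T t₃)
  T-quotient t₁ t₂ t₁≢0 t₂≢0 t₃ t₃≢0 = begin
    T (inv (t₁ · t₂) t₁₂≢0 · (-1F · t₃))       ≈⟨ T-· _ _ (Nonzero-inv _ t₁₂≢0) (Nonzero-· Nonzero-[-1] t₃≢0) ⟩
    T (inv (t₁ · t₂) t₁₂≢0) * T (-1F · t₃)     ≈⟨ *-cong (T-inv≈T^[p-2] (t₁ · t₂) t₁₂≢0) (T-· -1F t₃ Nonzero-[-1] t₃≢0) ⟩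
    T (t₁ · t₂) ^ n * (T -1F * T t₃)           ≈⟨ *-congʳ (trans (^-congˡ n (T-· t₁ t₂ t₁≢0 t₂≢0)) (^-distrib-* (T t₁) (T t₂) n)) ⟩
    T t₁ ^ n * T t₂ ^ n * (T -1F * T t₃)       ∎
    where t₁₂≢0 = Nonzero-· t₁≢0 t₂≢0

  sum-nonzero-invariant : ∀ k y → Nonzero y →
    T y ^ k * ∑[ i < suc n ] (T (Fin.suc i) ^ k) ≈ ∑[ i < suc n ] (T (Fin.suc i) ^ k)
  sum-nonzero-invariant k y y≢0 = sym (begin
    ∑[ i < suc n ] (T (Fin.suc i) ^ k)                               ≈⟨ ∑-permute (λ i → T (Fin.suc i) ^ k) (·-permutation y y≢0) ⟩
    ∑[ i < suc n ] (T (Fin.suc (·-permutation y y≢0 ⟨$⟩ʳ i)) ^ k)   ≈⟨ sum-cong-≋ (λ i → ^-congˡ k (T-permute y y≢0 i)) ⟩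
    ∑[ i < suc n ] ((T y * T (Fin.suc i)) ^ k)                       ≈⟨ sum-cong-≋ (λ i → ^-distrib-* (T y) (T (Fin.suc i)) k) ⟩
    ∑[ i < suc n ] (T y ^ k * T (Fin.suc i) ^ k)                     ≈⟨ *-distribˡ-sum (T y ^ k) (λ i → T (Fin.suc i) ^ k) ⟨
    T y ^ k * ∑[ i < suc n ] (T (Fin.suc i) ^ k)                     ∎)

  sum-T^k≈0 : ∀ k → 0 ℕ.< k → k ℕ.< suc n → ∑[ x < p ] (T x ^ k) ≈ 0#
  sum-T^k≈0 (suc k) _ k<p-1 = [ contradiction , sum≈0 ]′
    (finite-choice λ i → fixed-point-of-* domain (sum-nonzero-invariant (suc k) (Fin.suc i) (Nonzero-suc i)))
    where
    contradiction : (∀ i → T (Fin.suc i) ^ suc k ≈ 1#) → ∑[ x < p ] (T x ^ suc k) ≈ 0#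
    contradiction trivial = ⊥-elim (proj₂ generator (suc k) z<s k<p-1 λ
      { Fin.zero 0≢0 → ⊥-elim (0≢0 ≡.refl)
      ; (Fin.suc i) _ → trans (reflexive (^≡^ (T (Fin.suc i)) (suc k))) (trivial i) })
    sum≈0 : ∑[ i < suc n ] (T (Fin.suc i) ^ suc k) ≈ 0# → ∑[ x < p ] (T x ^ suc k) ≈ 0#
    sum≈0 S≈0 = trans (+-cong (T-0^suc k) S≈0) (+-identityʳ 0#)

  sum-T^[p-1] : ∑[ x < p ] (T x ^ suc n) ≈ Defs.ι R p (suc n)
  sum-T^[p-1] = begin
    T Fin.zero ^ suc n + ∑[ i < suc n ] (T (Fin.suc i) ^ suc n) ≈⟨ +-cong (T-0^suc n) (sum-cong-≋ (λ i → T-fermat (Fin.suc i) (Nonzero-suc i))) ⟩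
    0# + ∑[ i < suc n ] 1#                                      ≈⟨ +-identityˡ _ ⟩
    ∑[ i < suc n ] 1#                                           ≡⟨ ι≡sum-1 (suc n) ⟨
    Defs.ι R p (suc n)                                          ∎

  sum-T^k*product : ∀ m (a : Fin m → Carrier) k → 0 ℕ.< k → k ℕ.+ m ℕ.≤ suc n →
    ∑[ x < p ] (T x ^ k * product (λ j → T x - a j)) ≈ ∑[ x < p ] (T x ^ (k ℕ.+ m))
  sum-T^k*product zero    a k _   _ = sum-cong-≋ λ x → trans (*-identityʳ _) (^-congʳ (T x) (≡.sym (ℕ.+-identityʳ k)))
  sum-T^k*product (suc m) a k 0<k k+m<p = begin
    ∑[ x < p ] (T x ^ k * ((T x - a₀) * Π x))
      ≈⟨ sum-cong-≋ (λ x → expand (T x) (T x ^ k) (- a₀) (Π x)) ⟩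
    ∑[ x < p ] (T x ^ suc k * Π x + - a₀ * (T x ^ k * Π x))
      ≈⟨ ∑-distrib-+ (λ x → T x ^ suc k * Π x) (λ x → - a₀ * (T x ^ k * Π x)) ⟩
    ∑[ x < p ] (T x ^ suc k * Π x) + ∑[ x < p ] (- a₀ * (T x ^ k * Π x))
      ≈⟨ +-cong (sum-T^k*product m a′ (suc k) z<s k+m<p-1)
                (sym (*-distribˡ-sum (- a₀) (λ x → T x ^ k * Π x))) ⟩
    ∑[ x < p ] (T x ^ (suc k ℕ.+ m)) + - a₀ * ∑[ x < p ] (T x ^ k * Π x)
      ≈⟨ +-congˡ (*-congˡ (trans (sum-T^k*product m a′ k 0<k (ℕ.<⇒≤ k+m<p-1)) (sum-T^k≈0 (k ℕ.+ m) (ℕ.<-≤-trans 0<k (ℕ.m≤m+n k m)) k+m<p-1))) ⟩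
    ∑[ x < p ] (T x ^ (suc k ℕ.+ m)) + - a₀ * 0#
      ≈⟨ trans (+-congˡ (zeroʳ _)) (+-identityʳ _) ⟩
    ∑[ x < p ] (T x ^ (suc k ℕ.+ m))
      ≡⟨ ≡.cong (λ e → ∑[ x < p ] (T x ^ e)) (≡.sym (ℕ.+-suc k m)) ⟩
    ∑[ x < p ] (T x ^ (k ℕ.+ suc m)) ∎
    where
    expand : ∀ t y b q → y * ((t + b) * q) ≈ t * y * q + b * (y * q)
    expand t y b q = trans (*-congˡ (distribʳ q t b))
      (trans (distribˡ y (t * q) (b * q)) (+-cong (x∙yz≈yx∙z y t q) (x∙yz≈y∙xz y b q)))
    k+m<p-1 : k ℕ.+ m ℕ.< suc n
    k+m<p-1 = ≡.subst (ℕ._≤ suc n) (ℕ.+-suc k m) k+m<p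
    a₀ = a Fin.zero
    a′ = λ j → a (Fin.suc j)
    Π = λ x → product (λ j → T x - a′ j)

  -- The polynomial ∏_{v ∉ {0, u}} (X − T v) of degree p − 2 vanishes at every T x, x ≠ 0,
  -- because T u = 1 = T 1; summing it against T x, the lower terms cancel by orthogonality,
  -- leaving Σₓ T(x)^{p−1} = p − 1.
  T-kernel-nontrivial⇒ι[p-1]≈0 : ∀ u → Nonzero u → u ≢ 1F → T u ≈ 1# → Defs.ι R p (suc n) ≈ 0#
  T-kernel-nontrivial⇒ι[p-1]≈0 Fin.zero      u≢0 _   _    = ⊥-elim (u≢0 ≡.refl)
  T-kernel-nontrivial⇒ι[p-1]≈0 (Fin.suc u′) _   u≢1 Tu≈1 = begin
    Defs.ι R p (suc n)                                     ≈⟨ sum-T^[p-1] ⟨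
    ∑[ x < p ] (T x ^ suc n)                               ≈⟨ sum-T^k*product n a 1 z<s ℕ.≤-refl ⟨
    ∑[ x < p ] (T x ^ 1 * product (λ j → T x - a j))       ≈⟨ sum-≈0 vanishes ⟩
    0#                                                     ∎
    where
    a : Fin n → Carrier
    a j = T (Fin.suc (Fin.punchIn u′ j))
    a-punchOut : ∀ {x′} (u′≢x′ : u′ ≢ x′) → a (Fin.punchOut u′≢x′) ≈ T (Fin.suc x′)
    a-punchOut u′≢x′ = reflexive (≡.cong (λ y → T (Fin.suc y)) (Fin.punchIn-punchOut u′≢x′))
    factor≈0 : ∀ x′ → ∃ λ j → T (Fin.suc x′) - a j ≈ 0#
    factor≈0 x′ with x′ Fin.≟ u′
    ... | yes ≡.refl = Fin.punchOut u′≢0 , trans (+-cong (trans Tu≈1 (sym T-1)) (-‿cong (a-punchOut u′≢0))) (-‿inverseʳ _)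
      where u′≢0 = λ u′≡0 → u≢1 (≡.cong Fin.suc u′≡0)
    ... | no x′≢u′ = Fin.punchOut (x′≢u′ ∘ ≡.sym) , trans (+-congˡ (-‿cong (a-punchOut (x′≢u′ ∘ ≡.sym)))) (-‿inverseʳ _)
    vanishes : ∀ x → T x ^ 1 * product (λ j → T x - a j) ≈ 0#
    vanishes Fin.zero     = trans (*-congʳ (T-0^suc 0)) (zeroˡ _)
    vanishes (Fin.suc x′) = trans (*-congˡ (product-≈0 _ (proj₁ (factor≈0 x′)) (proj₂ (factor≈0 x′)))) (zeroʳ _)

  sum-powers : ∀ u → Nonzero u →
    ∑[ e < suc n ] (T u ^ toℕ e) ≈ (if does (u Fin.≟ 1F) then Defs.ι R p (suc n) else 0#)
  sum-powers u u≢0 = by-cases (u Fin.≟ 1F)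
    where
    by-cases : (u≟1 : Dec (u ≡ 1F)) →
      ∑[ e < suc n ] (T u ^ toℕ e) ≈ (if does u≟1 then Defs.ι R p (suc n) else 0#)
    by-cases (yes u≡1) = geometric-sum-of-1 (suc n) (trans (reflexive (≡.cong T u≡1)) T-1)
    by-cases (no u≢1)  = [ (λ Tu≈1 → trans (geometric-sum-of-1 (suc n) Tu≈1) (T-kernel-nontrivial⇒ι[p-1]≈0 u u≢0 u≢1 Tu≈1))
                         , id ]′
      (fixed-point-of-* domain (+-cancelʳ 1# _ _ (trans (geometric-sum (T u) (suc n)) (+-congˡ (T-fermat u u≢0)))))

  charPow : ℤ → Fin p → Carrier
  charPow z x = Defs.charPow R p T z x

  natExponent : ℤ → ℕ
  natExponent (+ m)    = m
  natExponent -[1+ m ] = n ℕ.* suc m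

  charPow-nonzero : ∀ z x → Nonzero x → charPow z x ≈ T x ^ natExponent z
  charPow-nonzero z        Fin.zero    x≢0 = ⊥-elim (x≢0 ≡.refl)
  charPow-nonzero (+ m)    (Fin.suc i) _   = reflexive (^≡^ (T (Fin.suc i)) m)
  charPow-nonzero -[1+ m ] (Fin.suc i) _   = reflexive (^≡^ (T (Fin.suc i)) (n ℕ.* suc m))

  charPow-· : ∀ z x y → Nonzero x → Nonzero y → charPow z (x · y) ≈ charPow z x * charPow z y
  charPow-· z x y x≢0 y≢0 = begin
    charPow z (x · y)                     ≈⟨ charPow-nonzero z (x · y) (Nonzero-· x≢0 y≢0) ⟩
    T (x · y) ^ natExponent z             ≈⟨ ^-congˡ (natExponent z) (T-· x y x≢0 y≢0) ⟩
    (T x * T y) ^ natExponent z           ≈⟨ ^-distrib-* (T x) (T y) (natExponent z) ⟩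
    T x ^ natExponent z * T y ^ natExponent z ≈⟨ *-cong (charPow-nonzero z x x≢0) (charPow-nonzero z y y≢0) ⟨
    charPow z x * charPow z y             ∎

  module Power (x : Fin p) (x≢0 : Nonzero x) = UnitPowers (T x) (T x ^ n) (T-fermat x x≢0)

  charPow≈pow : ∀ x (x≢0 : Nonzero x) z → charPow z x ≈ Power.pow x x≢0 z
  charPow≈pow x x≢0 (+ m)    = charPow-nonzero (+ m) x x≢0
  charPow≈pow x x≢0 -[1+ m ] = trans (charPow-nonzero -[1+ m ] x x≢0) (sym (^-assocʳ (T x) n (suc m)))

  charPow-homo-+ : ∀ x z w → charPow (z ℤ.+ w) x ≈ charPow z x * charPow w x
  charPow-homo-+ Fin.zero    z w = sym (zeroˡ 0#)
  charPow-homo-+ (Fin.suc i) z w = begin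
    charPow (z ℤ.+ w) x          ≈⟨ charPow≈pow x x≢0 (z ℤ.+ w) ⟩
    pow (z ℤ.+ w)                ≈⟨ pow-homo-+ z w ⟩
    pow z * pow w                ≈⟨ *-cong (charPow≈pow x x≢0 z) (charPow≈pow x x≢0 w) ⟨
    charPow z x * charPow w x    ∎
    where
    x = Fin.suc i
    x≢0 = Nonzero-suc i
    open Power x x≢0

  charPow-neg+ : ∀ x (x≢0 : Nonzero x) e z → charPow (ℤ.- (+ e) ℤ.+ z) x ≈ (T x ^ n) ^ e * charPow z x
  charPow-neg+ x x≢0 e z = trans (charPow-homo-+ x (ℤ.- (+ e)) z)
    (*-congʳ (trans (charPow≈pow x x≢0 (ℤ.- (+ e))) (Power.pow-neg x x≢0 e)))

  charPow-pos+ : ∀ x (x≢0 : Nonzero x) e z → charPow (+ e ℤ.+ z) x ≈ T x ^ e * charPow z x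
  charPow-pos+ x x≢0 e z = trans (charPow-homo-+ x (+ e) z) (*-congʳ (charPow-nonzero (+ e) x x≢0))

  charPow-1 : ∀ z → charPow z 1F ≈ 1#
  charPow-1 z = begin
    charPow z 1F                       ≈⟨ charPow≈pow 1F 1≢0 z ⟩
    pow z                              ≡⟨ ≡.cong pow (ℤ.*-identityʳ z) ⟨
    pow (z ℤ.* + 1)                    ≈⟨ pow-multiple 1 (trans (*-identityʳ _) T-1) z ⟩
    1#                                 ∎
    where
    1≢0 = Nonzero-suc Fin.zero
    open Power 1F 1≢0

  charPow-pos : ∀ m x → 0 ℕ.< m → charPow (+ m) x ≈ T x ^ m
  charPow-pos (suc m) Fin.zero    _ = sym (T-0^suc m)
  charPow-pos m       (Fin.suc i) _ = charPow-nonzero (+ m) (Fin.suc i) (Nonzero-suc i)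

  charPow-%ℕ : ∀ z x → charPow z x ≈ charPow (+ (z ℤ.%ℕ suc n)) x
  charPow-%ℕ z Fin.zero    = refl
  charPow-%ℕ z (Fin.suc i) = begin
    charPow z x                                       ≡⟨ ≡.cong (λ w → charPow w x) (a≡a%ℕn+[a/ℕn]*n z (suc n)) ⟩
    charPow (+ (z ℤ.%ℕ suc n) ℤ.+ z ℤ./ℕ suc n ℤ.* + suc n) x
      ≈⟨ charPow-homo-+ x (+ (z ℤ.%ℕ suc n)) (z ℤ./ℕ suc n ℤ.* + suc n) ⟩
    charPow (+ (z ℤ.%ℕ suc n)) x * charPow (z ℤ./ℕ suc n ℤ.* + suc n) x
      ≈⟨ *-congˡ (trans (charPow≈pow x x≢0 (z ℤ./ℕ suc n ℤ.* + suc n)) (pow-multiple (suc n) (T-fermat x x≢0) (z ℤ./ℕ suc n))) ⟩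
    charPow (+ (z ℤ.%ℕ suc n)) x * 1#                ≈⟨ *-identityʳ _ ⟩
    charPow (+ (z ℤ.%ℕ suc n)) x                      ∎
    where
    x = Fin.suc i
    x≢0 = Nonzero-suc i
    open Power x x≢0

  sum-charPow≈0 : ∀ z → ¬ (+ suc n ∣ℤ z) → ∑[ x < p ] charPow z x ≈ 0#
  sum-charPow≈0 z p-1∤z = begin
    ∑[ x < p ] charPow z x                   ≈⟨ sum-cong-≋ (charPow-%ℕ z) ⟩
    ∑[ x < p ] charPow (+ r) x               ≈⟨ sum-cong-≋ (λ x → charPow-pos r x 0<r) ⟩
    ∑[ x < p ] (T x ^ r)                     ≈⟨ sum-T^k≈0 r 0<r (n%ℕd<d z (suc n)) ⟩
    0#                                       ∎
    where
    r = z ℤ.%ℕ suc n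
    0<r : 0 ℕ.< r
    0<r = ℕ.n≢0⇒n>0 λ r≡0 → p-1∤z (%ℕ≡0⇒∣ z (suc n) r≡0)

module JacobiSum {c ℓ} (R : CommutativeRing c ℓ) (domain : IsIntegralDomain R)
                 (n : ℕ) (isPrime : Prime (suc (suc n))) (p%5≡1 : suc (suc n) % 5 ≡ 1)
                 (T : Fin (suc (suc n)) → CommutativeRing.Carrier R)
                 (generator : Defs.IsGenerator R (suc (suc n)) T)
                 (a b c : ℤ) where
  open CommutativeRing R
  open RingProperties R
  open DefsProperties R (suc (suc n))
  open PrimeField n isPrime
  open OneModFive p%5≡1
  open Character R domain n isPrime T generator
  open import Relation.Binary.Reasoning.Setoid setoid

  A B C : ℤ
  A = a ℤ.* + t
  B = b ℤ.* + t
  C = c ℤ.* + t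

  ι[p-1] : Carrier
  ι[p-1] = Defs.ι R p (suc n)

  χ₁ χ₂ χ₃ : ℕ → Fin p → Carrier
  χ₁ e = charPow (ℤ.- (+ e) ℤ.+ A)
  χ₂ e = charPow (ℤ.- (+ e) ℤ.+ B)
  χ₃ e = charPow (+ e ℤ.+ C)

  onPlane? : Fin p → Fin p → Fin p → Bool
  onPlane? t₁ t₂ t₃ = does ((toℕ t₁ ℕ.+ toℕ t₂ ℕ.+ toℕ t₃) % p ℕ.≟ 1 % p)

  K : Fin p → Fin p → Fin p → Carrier
  K t₁ t₂ t₃ = charPow A t₁ * charPow B t₂ * charPow C t₃

  K′ : Fin p → Fin p → Carrier
  K′ t₁ t₂ = K t₁ t₂ (-1F · (t₁ · t₂))

  summand-factorises : ∀ e t₁ t₂ (t₁≢0 : Nonzero t₁) (t₂≢0 : Nonzero t₂) t₃ → Nonzero t₃ →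
    T -1F ^ e * (χ₁ e t₁ * χ₂ e t₂ * χ₃ e t₃) ≈ K t₁ t₂ t₃ * T (quotient t₁ t₂ t₁≢0 t₂≢0 t₃) ^ e
  summand-factorises e t₁ t₂ t₁≢0 t₂≢0 t₃ t₃≢0 = begin
    σ ^ e * (χ₁ e t₁ * χ₂ e t₂ * χ₃ e t₃)
      ≈⟨ *-congˡ (*-cong (*-cong (charPow-neg+ t₁ t₁≢0 e A) (charPow-neg+ t₂ t₂≢0 e B)) (charPow-pos+ t₃ t₃≢0 e C)) ⟩
    σ ^ e * ((u₁ ^ e * charPow A t₁) * (u₂ ^ e * charPow B t₂) * (τ₃ ^ e * charPow C t₃))
      ≈⟨ rearrange (σ ^ e) (u₁ ^ e) (u₂ ^ e) (τ₃ ^ e) (charPow A t₁) (charPow B t₂) (charPow C t₃) ⟩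
    K t₁ t₂ t₃ * ((u₁ ^ e * u₂ ^ e) * (σ ^ e * τ₃ ^ e))
      ≈⟨ *-congˡ (*-cong (^-distrib-* u₁ u₂ e) (^-distrib-* σ τ₃ e)) ⟨
    K t₁ t₂ t₃ * ((u₁ * u₂) ^ e * (σ * τ₃) ^ e)
      ≈⟨ *-congˡ (^-distrib-* (u₁ * u₂) (σ * τ₃) e) ⟨
    K t₁ t₂ t₃ * (u₁ * u₂ * (σ * τ₃)) ^ e
      ≈⟨ *-congˡ (^-congˡ e (T-quotient t₁ t₂ t₁≢0 t₂≢0 t₃ t₃≢0)) ⟨
    K t₁ t₂ t₃ * T (quotient t₁ t₂ t₁≢0 t₂≢0 t₃) ^ e ∎
    where
    σ = T -1F
    u₁ = T t₁ ^ n
    u₂ = T t₂ ^ n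
    τ₃ = T t₃
    rearrange : ∀ s x y z a b c → s * ((x * a) * (y * b) * (z * c)) ≈ (a * b * c) * ((x * y) * (s * z))
    rearrange = solve 7 (λ s x y z a b c → s :* ((x :* a) :* (y :* b) :* (z :* c)) := (a :* b :* c) :* ((x :* y) :* (s :* z))) refl

  sum-over-e-degenerate : ∀ t₁ t₂ t₃ →
    (∀ {e} → χ₁ e t₁ ≈ 0# ⊎ χ₂ e t₂ ≈ 0# ⊎ χ₃ e t₃ ≈ 0#) → (charPow A t₁ ≈ 0# ⊎ charPow B t₂ ≈ 0# ⊎ charPow C t₃ ≈ 0#) →
    ∑[ e < suc n ] (T -1F ^ toℕ e * (χ₁ (toℕ e) t₁ * χ₂ (toℕ e) t₂ * χ₃ (toℕ e) t₃))
      ≈ (if does (t₃ Fin.≟ -1F · (t₁ · t₂)) then ι[p-1] * K t₁ t₂ t₃ else 0#)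
  sum-over-e-degenerate t₁ t₂ t₃ χ≈0 K≈0 = trans (sum-≈0 {suc n} {λ e → T -1F ^ toℕ e * (χ₁ (toℕ e) t₁ * χ₂ (toℕ e) t₂ * χ₃ (toℕ e) t₃)} λ e → trans (*-congˡ (*-*-≈0 χ≈0)) (zeroʳ _))
                                    (sym (if-≈0 (does (t₃ Fin.≟ -1F · (t₁ · t₂))) (trans (*-congˡ (*-*-≈0 K≈0)) (zeroʳ _))))

  sum-over-e : ∀ t₁ t₂ t₃ → ∑[ e < suc n ] (T -1F ^ toℕ e * (χ₁ (toℕ e) t₁ * χ₂ (toℕ e) t₂ * χ₃ (toℕ e) t₃))
                            ≈ (if does (t₃ Fin.≟ -1F · (t₁ · t₂)) then ι[p-1] * K t₁ t₂ t₃ else 0#)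
  sum-over-e Fin.zero    t₂          t₃          = sum-over-e-degenerate Fin.zero t₂ t₃ (inj₁ refl) (inj₁ refl)
  sum-over-e (Fin.suc i) Fin.zero    t₃          = sum-over-e-degenerate (Fin.suc i) Fin.zero t₃ (inj₂ (inj₁ refl)) (inj₂ (inj₁ refl))
  sum-over-e (Fin.suc i) (Fin.suc j) Fin.zero    = sum-over-e-degenerate (Fin.suc i) (Fin.suc j) Fin.zero (inj₂ (inj₂ refl)) (inj₂ (inj₂ refl))
  sum-over-e (Fin.suc i) (Fin.suc j) (Fin.suc k) = begin
    ∑[ e < suc n ] (T -1F ^ toℕ e * (χ₁ (toℕ e) t₁ * χ₂ (toℕ e) t₂ * χ₃ (toℕ e) t₃))
      ≈⟨ sum-cong-≋ {suc n} (λ e → summand-factorises (toℕ e) t₁ t₂ t₁≢0 t₂≢0 t₃ t₃≢0) ⟩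
    ∑[ e < suc n ] (K t₁ t₂ t₃ * T w ^ toℕ e)
      ≈⟨ *-distribˡ-sum {suc n} (K t₁ t₂ t₃) (λ e → T w ^ toℕ e) ⟨
    K t₁ t₂ t₃ * ∑[ e < suc n ] (T w ^ toℕ e)
      ≈⟨ *-congˡ (sum-powers w (Nonzero-· (Nonzero-inv _ (Nonzero-· t₁≢0 t₂≢0)) (Nonzero-· Nonzero-[-1] t₃≢0))) ⟩
    K t₁ t₂ t₃ * (if does (w Fin.≟ 1F) then ι[p-1] else 0#)
      ≈⟨ *-if (does (w Fin.≟ 1F)) (K t₁ t₂ t₃) ι[p-1] ⟩
    (if does (w Fin.≟ 1F) then K t₁ t₂ t₃ * ι[p-1] else 0#)
      ≡⟨ ≡.cong (λ β → if β then K t₁ t₂ t₃ * ι[p-1] else 0#)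
                (does-⇔ (quotient≡1⇔ t₁ t₂ t₁≢0 t₂≢0 t₃) (w Fin.≟ 1F) (t₃ Fin.≟ -1F · (t₁ · t₂))) ⟩
    (if does (t₃ Fin.≟ -1F · (t₁ · t₂)) then K t₁ t₂ t₃ * ι[p-1] else 0#)
      ≈⟨ if-cong (does (t₃ Fin.≟ -1F · (t₁ · t₂))) (*-comm _ _) ⟩
    (if does (t₃ Fin.≟ -1F · (t₁ · t₂)) then ι[p-1] * K t₁ t₂ t₃ else 0#) ∎
    where
    t₁ = Fin.suc i
    t₂ = Fin.suc j
    t₃ = Fin.suc k
    t₁≢0 = Nonzero-suc i
    t₂≢0 = Nonzero-suc j
    t₃≢0 = Nonzero-suc k
    w = quotient t₁ t₂ t₁≢0 t₂≢0 t₃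

  sum-over-t₃ : ∀ t₁ t₂ →
    ∑[ t₃ < p ] (if onPlane? t₁ t₂ t₃ then (if does (t₃ Fin.≟ -1F · (t₁ · t₂)) then ι[p-1] * K t₁ t₂ t₃ else 0#) else 0#)
      ≈ (if onPlane? t₁ t₂ (-1F · (t₁ · t₂)) then ι[p-1] * K′ t₁ t₂ else 0#)
  sum-over-t₃ t₁ t₂ = trans (sum-cong-≋ (λ t₃ → reflexive (if-if-comm (onPlane? t₁ t₂ t₃) (does (t₃ Fin.≟ -1F · (t₁ · t₂))) (ι[p-1] * K t₁ t₂ t₃))))
                            (sum-δ (-1F · (t₁ · t₂)) (λ t₃ → if onPlane? t₁ t₂ t₃ then ι[p-1] * K t₁ t₂ t₃ else 0#))

  on-lines : ∀ t₁ t₂ → (if onPlane? t₁ t₂ (-1F · (t₁ · t₂)) then ι[p-1] * K′ t₁ t₂ else 0#)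
                       ≈ (if does (t₁ Fin.≟ 1F) ∨ does (t₂ Fin.≟ 1F) then ι[p-1] * K′ t₁ t₂ else 0#)
  on-lines Fin.zero    t₂       = trans (if-≈0 _ ιK′≈0) (sym (if-≈0 _ ιK′≈0))
    where ιK′≈0 = trans (*-congˡ (*-*-≈0 (inj₁ refl))) (zeroʳ ι[p-1])
  on-lines (Fin.suc i) Fin.zero = trans (if-≈0 _ ιK′≈0) (sym (if-≈0 _ ιK′≈0))
    where ιK′≈0 = trans (*-congˡ (*-*-≈0 (inj₂ (inj₁ refl)))) (zeroʳ ι[p-1])
  on-lines (Fin.suc i) (Fin.suc j) = reflexive (≡.cong (λ β → if β then ι[p-1] * K′ (Fin.suc i) (Fin.suc j) else 0#)
    (does-⇔ (on-plane⇔ i j) (_ ℕ.≟ _) (Fin.suc i Fin.≟ 1F ⊎-dec Fin.suc j Fin.≟ 1F)))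

  charPow-C-[-1] : charPow C -1F ≈ 1#
  charPow-C-[-1] = begin
    charPow C -1F                  ≈⟨ charPow≈pow -1F Nonzero-[-1] C ⟩
    pow (c ℤ.* + t)                ≡⟨ ≡.cong pow c*t≡c*s*2 ⟩
    pow (c ℤ.* + s ℤ.* + 2)        ≈⟨ pow-multiple 2 T[-1]^2≈1 (c ℤ.* + s) ⟩
    1#                             ∎
    where
    open Power -1F Nonzero-[-1]
    s = proj₁ t-even
    c*t≡c*s*2 : c ℤ.* + t ≡ c ℤ.* + s ℤ.* + 2
    c*t≡c*s*2 = ≡.trans (≡.cong (λ k → c ℤ.* + k) (proj₂ t-even))
                (≡.trans (≡.cong (c ℤ.*_) (ℤ.pos-* s 2)) (≡.sym (ℤ.*-assoc c (+ s) (+ 2))))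
    T[-1]^2≈1 : T -1F ^ 2 ≈ 1#
    T[-1]^2≈1 = trans (*-congˡ (*-identityʳ _))
                (trans (sym (T-· -1F -1F Nonzero-[-1] Nonzero-[-1])) (trans (reflexive (≡.cong T -1·-1≡1)) T-1))

  charPow-C-negate : ∀ x → Nonzero x → charPow C (-1F · x) ≈ charPow C x
  charPow-C-negate x x≢0 = trans (charPow-· C -1F x Nonzero-[-1] x≢0) (trans (*-congʳ charPow-C-[-1]) (*-identityˡ _))

  K′-1ˡ : ∀ t₂ → K′ 1F t₂ ≈ charPow (B ℤ.+ C) t₂
  K′-1ˡ Fin.zero    = *-*-≈0 (inj₂ (inj₁ refl))
  K′-1ˡ (Fin.suc j) = begin
    charPow A 1F * charPow B t₂ * charPow C (-1F · (1F · t₂))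
      ≈⟨ *-cong (*-congʳ (charPow-1 A)) (trans (reflexive (≡.cong (λ x → charPow C (-1F · x)) (·-identityˡ t₂)))
                                               (charPow-C-negate t₂ (Nonzero-suc j))) ⟩
    1# * charPow B t₂ * charPow C t₂      ≈⟨ *-congʳ (*-identityˡ _) ⟩
    charPow B t₂ * charPow C t₂           ≈⟨ charPow-homo-+ t₂ B C ⟨
    charPow (B ℤ.+ C) t₂                  ∎
    where t₂ = Fin.suc j

  K′-1ʳ : ∀ t₁ → K′ t₁ 1F ≈ charPow (A ℤ.+ C) t₁
  K′-1ʳ Fin.zero    = *-*-≈0 (inj₁ refl)
  K′-1ʳ (Fin.suc i) = begin
    charPow A t₁ * charPow B 1F * charPow C (-1F · (t₁ · 1F))
      ≈⟨ *-cong (*-congˡ (charPow-1 B)) (trans (reflexive (≡.cong (λ x → charPow C (-1F · x)) (·-identityʳ t₁)))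
                                               (charPow-C-negate t₁ (Nonzero-suc i))) ⟩
    charPow A t₁ * 1# * charPow C t₁      ≈⟨ *-congʳ (*-identityʳ _) ⟩
    charPow A t₁ * charPow C t₁           ≈⟨ charPow-homo-+ t₁ A C ⟨
    charPow (A ℤ.+ C) t₁                  ∎
    where t₁ = Fin.suc i

  K′-11 : K′ 1F 1F ≈ 1#
  K′-11 = begin
    charPow A 1F * charPow B 1F * charPow C (-1F · (1F · 1F))
      ≡⟨ ≡.cong (λ x → charPow A 1F * charPow B 1F * charPow C x) (≡.trans (≡.cong (-1F ·_) (·-identityˡ 1F)) (·-identityʳ -1F)) ⟩
    charPow A 1F * charPow B 1F * charPow C -1F ≈⟨ *-cong (*-cong (charPow-1 A) (charPow-1 B)) charPow-C-[-1] ⟩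
    1# * 1# * 1#                                ≈⟨ trans (*-identityʳ _) (*-identityˡ _) ⟩
    1#                                          ∎

  sum-charPow-[d*t]≈0 : ∀ d → ¬ (+ 5 ∣ℤ d) → ∑[ x < p ] charPow (d ℤ.* + t) x ≈ 0#
  sum-charPow-[d*t]≈0 d 5∤d = sum-charPow≈0 (d ℤ.* + t) λ p-1∣dt →
    5∤d (ℤ.*-cancelʳ-∣ (+ t) {+ 5} {d} {{t≢0}} (≡.subst (_∣ℤ d ℤ.* + t) p-1≡5*t p-1∣dt))
    where
    t≢0 : ℕ.NonZero t
    t≢0 = ℕ.≢-nonZero λ t≡0 → ℕ.1+n≢0 (≡.trans p-1≡t*5 (≡.cong (ℕ._* 5) t≡0))
    p-1≡5*t : + suc n ≡ + 5 ℤ.* + t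
    p-1≡5*t = ≡.trans (≡.cong +_ (≡.trans p-1≡t*5 (ℕ.*-comm t 5))) (ℤ.pos-* 5 t)

  line-sum≈0 : ∀ d → ¬ (+ 5 ∣ℤ d) → (f : Fin p → Carrier) → (∀ x → f x ≈ charPow (d ℤ.* + t) x) →
               ∑[ x < p ] (ι[p-1] * f x) ≈ 0#
  line-sum≈0 d 5∤d f f≈ = trans (sym (*-distribˡ-sum ι[p-1] f))
    (trans (*-congˡ (trans (sum-cong-≋ f≈) (sum-charPow-[d*t]≈0 d 5∤d))) (zeroʳ _))

  twisted-sum-of-Jacobi-sums : ¬ (+ 5 ∣ℤ a ℤ.+ c) → ¬ (+ 5 ∣ℤ b ℤ.+ c) →
    Defs.∑< R p (suc n) (λ e → charPow (+ e) -1F * Defs.J₃ R p (χ₁ e) (χ₂ e) (χ₃ e)) ≈ - ι[p-1]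
  twisted-sum-of-Jacobi-sums 5∤a+c 5∤b+c = begin
    Defs.∑< R p (suc n) (λ e → charPow (+ e) -1F * Defs.J₃ R p (χ₁ e) (χ₂ e) (χ₃ e))
      ≈⟨ ∑<≈sum (suc n) _ ⟩
    ∑[ e < suc n ] (charPow (+ toℕ e) -1F * Defs.J₃ R p (χ₁ (toℕ e)) (χ₂ (toℕ e)) (χ₃ (toℕ e)))
      ≈⟨ sum-cong-≋ {suc n} (λ e → *-cong (charPow-nonzero (+ toℕ e) -1F Nonzero-[-1]) (J₃≈∑³ (χ₁ (toℕ e)) (χ₂ (toℕ e)) (χ₃ (toℕ e)))) ⟩
    ∑[ e < suc n ] (T -1F ^ toℕ e * ∑³ (Y (toℕ e)))
      ≈⟨ sum-cong-≋ {suc n} (λ e → *-distribˡ-∑³ (T -1F ^ toℕ e) (Y (toℕ e))) ⟩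
    ∑[ e < suc n ] ∑³ (λ t₁ t₂ t₃ → T -1F ^ toℕ e * Y (toℕ e) t₁ t₂ t₃)
      ≈⟨ ∑-∑³-comm {suc n} (λ e t₁ t₂ t₃ → T -1F ^ toℕ e * Y (toℕ e) t₁ t₂ t₃) ⟩
    ∑³ (λ t₁ t₂ t₃ → ∑[ e < suc n ] (T -1F ^ toℕ e * Y (toℕ e) t₁ t₂ t₃))
      ≈⟨ ∑³-cong (λ t₁ t₂ t₃ → trans (sum-cong-≋ {suc n} (λ e → *-if (onPlane? t₁ t₂ t₃) (T -1F ^ toℕ e) (X (toℕ e) t₁ t₂ t₃)))
                              (trans (sum-if {suc n} (onPlane? t₁ t₂ t₃) (λ e → T -1F ^ toℕ e * X (toℕ e) t₁ t₂ t₃))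
                                     (if-cong (onPlane? t₁ t₂ t₃) (sum-over-e t₁ t₂ t₃)))) ⟩
    ∑³ (λ t₁ t₂ t₃ → if onPlane? t₁ t₂ t₃ then (if does (t₃ Fin.≟ -1F · (t₁ · t₂)) then ι[p-1] * K t₁ t₂ t₃ else 0#) else 0#)
      ≈⟨ sum-cong-≋ (λ t₁ → sum-cong-≋ (λ t₂ → trans (sum-over-t₃ t₁ t₂) (on-lines t₁ t₂))) ⟩
    ∑[ t₁ < p ] ∑[ t₂ < p ] (if does (t₁ Fin.≟ 1F) ∨ does (t₂ Fin.≟ 1F) then ι[p-1] * K′ t₁ t₂ else 0#)
      ≈⟨ sum-if-∨ 1F (λ t₁ t₂ → ι[p-1] * K′ t₁ t₂) ⟩
    ∑[ t₂ < p ] (ι[p-1] * K′ 1F t₂) + ∑[ t₁ < p ] (ι[p-1] * K′ t₁ 1F) - ι[p-1] * K′ 1F 1F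
      ≈⟨ +-cong (+-cong (line-sum≈0 (b ℤ.+ c) 5∤b+c (K′ 1F) λ t₂ → trans (K′-1ˡ t₂) (reflexive (≡.cong (λ z → charPow z t₂) (≡.sym (ℤ.*-distribʳ-+ (+ t) b c)))))
                        (line-sum≈0 (a ℤ.+ c) 5∤a+c (λ t₁ → K′ t₁ 1F) λ t₁ → trans (K′-1ʳ t₁) (reflexive (≡.cong (λ z → charPow z t₁) (≡.sym (ℤ.*-distribʳ-+ (+ t) a c))))))
                (-‿cong (trans (*-congˡ K′-11) (*-identityʳ ι[p-1]))) ⟩
    0# + 0# - ι[p-1]
      ≈⟨ trans (+-congʳ (+-identityˡ 0#)) (+-identityˡ _) ⟩
    - ι[p-1] ∎
    where
    X Y : ℕ → Fin p → Fin p → Fin p → Carrier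
    X e t₁ t₂ t₃ = χ₁ e t₁ * χ₂ e t₂ * χ₃ e t₃
    Y e t₁ t₂ t₃ = if onPlane? t₁ t₂ t₃ then X e t₁ t₂ t₃ else 0#

open Defs using (IsGenerator; ∑<; charPow; [_]; J₃; ι)
open import Data.Integer using (-_; _+_; _*_)
open import Data.Integer.Divisibility using (_∣_)
open import Data.Nat.Primality using (¬prime[1])

lemma2p11 : ∀ {r ℓ} (R : CommutativeRing r ℓ) → IsIntegralDomain R →
  (p : ℕ) .{{_ : NonZero p}} → Prime p → p % 5 ≡ 1 →
  (T : Fin p → CommutativeRing.Carrier R) → IsGenerator R p T →
  (a b c : ℤ) → ¬ (+ 5 ∣ a + c) → ¬ (+ 5 ∣ b + c) →
  CommutativeRing._≈_ R
    (∑< R p (p ∸ 1) (λ e →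
       CommutativeRing._*_ R
         (charPow R p T (+ e) ([_] R p (p ∸ 1)))
         (J₃ R p (charPow R p T (- (+ e) + a * + ((p ∸ 1) / 5)))
                 (charPow R p T (- (+ e) + b * + ((p ∸ 1) / 5)))
                 (charPow R p T (+ e + c * + ((p ∸ 1) / 5))))))
    (CommutativeRing.-_ R (ι R p (p ∸ 1)))
lemma2p11 R domain zero          _     ()
lemma2p11 R domain (suc zero)    isPrime _     = ⊥-elim (¬prime[1] isPrime)
lemma2p11 R domain (suc (suc n)) isPrime p%5≡1 T generator a b c =
  JacobiSum.twisted-sum-of-Jacobi-sums R domain n isPrime p%5≡1 T generator a b c
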